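{- For any integers $k,\ell\ge 2$ there exists a graph $G$ such that $G\notin\mathrm{TD}_k\mathrm{MTD}_\ell$, but $G\in\mathrm{MW}_{2\ell}\mathrm{MTD}_0$.
   Context: Graphs are finite and simple. Operations: $\circ,\bullet$ return the empty and the one-vertex graph; $\mathrm{Union}_t$ ($t\ge2$) is disjoint union; $\mathrm{Join}_t$ is disjoint union plus all edges between different arguments; $\mathrm{Inc}_{x,E_x}(G)=(V\cup\{x\},E\cup E_x)$ for $G=(V,E)$, $x\notin V$, $E_x\subseteq\{\{x,v\}\mid v\in V\}$; $\mathrm{Subst}_H(G_1,\dots,G_t)$ for $V(H)=\{v_1,\dots,v_t\}$ replaces each $v_i$ by a disjoint copy of $G_i$ and adds all edges between $V(G_i)$ and $V(G_j)$ whenever $\{v_i,v_j\}\in E(H)$. A graph has an algebraic expression over a set of operations if it is (up to renaming) the value of it; the empty graph corresponds to the empty expression. The nesting depth of an operation is the maximum number of expression-tree nodes labelled by it on a root-to-leaf path. $\mathrm{td}(G)$ is the least $k$ such that $G$ has an expression over $\{\circ,\mathrm{Union}\}\cup\{\mathrm{Inc}_{x,E_x}\}$ with $\mathrm{Inc}$ nesting depth at most $k$. $\mathrm{TD}_k\mathrm{MTD}_\ell$: graphs with an expression over $\{\circ,\bullet,\mathrm{Union},\mathrm{Join}\}\cup\{\mathrm{Inc}_{x,E_x}\}\cup\{\mathrm{Subst}_H\mid\mathrm{td}(H)\le\ell\}$ with $\mathrm{Inc}$ nesting depth at most $k$. $\mathrm{MW}_h\mathrm{MTD}_\ell$: graphs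 with an expression over $\{\bullet,\mathrm{Union},\mathrm{Join}\}\cup\{\mathrm{Subst}_H\mid|V(H)|\le h\}\cup\{\mathrm{Subst}_H\mid\mathrm{td}(H)\le\ell\}$. -}

module Defs where

open import Data.Nat using (ℕ; zero; suc; _≤_)
open import Data.Fin using (Fin; _≟_)
open import Data.Bool using (Bool; true; false)
open import Data.Unit using (⊤)
open import Data.Empty using (⊥)
open import Data.Maybe using (Maybe; just; nothing)
open import Data.Product using (Σ; ∃; _×_; _,_)
open import Data.Sum using (_⊎_)
open import Function.Bundles using (_↔_; Inverse)
open import Relation.Binary.PropositionalEquality using (_≡_; refl)
open import Relation.Nullary using (yes; no)

record Graph : Set₁ where
  field
    V   : Set
    adj : V → V → Bool
open Graph public

IsSimple : Graph → Set
IsSimple G = (∀ u v → adj G u v ≡ adj G v u) × (∀ u → adj G u u ≡ false)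

IsFinite : Graph → Set
IsFinite G = ∃ λ n → V G ↔ Fin n

record _≅_ (G H : Graph) : Set where
  field
    bij      : V G ↔ V H
    preserve : ∀ u v → adj G u v ≡ adj H (Inverse.to bij u) (Inverse.to bij v)

emptyG : Graph
emptyG = record { V = ⊥ ; adj = λ () }

singleG : Graph
singleG = record { V = ⊤ ; adj = λ _ _ → false }

-- a graph on vertex set {v_1..v_t} = Fin t
FinGraph : ℕ → Set
FinGraph t = Fin t → Fin t → Bool

toGraph : ∀ {t} → FinGraph t → Graph
toGraph {t} H = record { V = Fin t ; adj = H }

-- Subst_H(G_1,…,G_t): vertex (i , a) is vertex a of the copy of G_i
substAdj : ∀ {t} (H : FinGraph t) (Gs : Fin t → Graph) →
           Σ (Fin t) (λ i → V (Gs i)) → Σ (Fin t) (λ i → V (Gs i)) → Bool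
substAdj H Gs (i , a) (j , b) with i ≟ j
... | yes refl = adj (Gs i) a b
... | no _     = H i j

substG : ∀ {t} → FinGraph t → (Fin t → Graph) → Graph
substG {t} H Gs = record { V = Σ (Fin t) (λ i → V (Gs i)) ; adj = substAdj H Gs }

unionG : ∀ {t} → (Fin t → Graph) → Graph
unionG = substG (λ _ _ → false)

joinG : ∀ {t} → (Fin t → Graph) → Graph
joinG = substG (λ _ _ → true)

-- Inc_{x,E_x}(G): new vertex x = nothing, E_x given by its neighbourhood
incAdj : (G : Graph) → (V G → Bool) → Maybe (V G) → Maybe (V G) → Bool
incAdj G ex nothing  nothing  = false
incAdj G ex nothing  (just v) = ex v
incAdj G ex (just u) nothing  = ex u
incAdj G ex (just u) (just v) = adj G u v

incG : (G : Graph) → (V G → Bool) → Graph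
incG G ex = record { V = Maybe (V G) ; adj = incAdj G ex }

-- Algebraic expressions (all operations); subclasses via predicates

mutual
  data Expr : Set₁ where
    circ   : Expr
    bullet : Expr
    union  : (t : ℕ) → 2 ≤ t → (Fin t → Expr) → Expr
    join   : (t : ℕ) → 2 ≤ t → (Fin t → Expr) → Expr
    inc    : (e : Expr) → (V (eval e) → Bool) → Expr
    subst  : (t : ℕ) → FinGraph t → (Fin t → Expr) → Expr

  eval : Expr → Graph
  eval circ           = emptyG
  eval bullet         = singleG
  eval (union t _ es) = unionG (λ i → eval (es i))
  eval (join t _ es)  = joinG (λ i → eval (es i))
  eval (inc e ex)     = incG (eval e) ex
  eval (subst t H es) = substG H (λ i → eval (es i))

data TDExpr : ℕ → Expr → Set₁ where
  circ  : ∀ {k} → TDExpr k circ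
  union : ∀ {k} t (p : 2 ≤ t) es → (∀ i → TDExpr k (es i)) → TDExpr k (union t p es)
  inc   : ∀ {k} e ex → TDExpr k e → TDExpr (suc k) (inc e ex)

TD≤ : ℕ → Graph → Set₁
TD≤ k G = ∃ λ e → TDExpr k e × (eval e ≅ G)

data TDMTDExpr (ℓ : ℕ) : ℕ → Expr → Set₁ where
  circ   : ∀ {k} → TDMTDExpr ℓ k circ
  bullet : ∀ {k} → TDMTDExpr ℓ k bullet
  union  : ∀ {k} t (p : 2 ≤ t) es → (∀ i → TDMTDExpr ℓ k (es i)) → TDMTDExpr ℓ k (union t p es)
  join   : ∀ {k} t (p : 2 ≤ t) es → (∀ i → TDMTDExpr ℓ k (es i)) → TDMTDExpr ℓ k (join t p es)
  inc    : ∀ {k} e ex → TDMTDExpr ℓ k e → TDMTDExpr ℓ (suc k) (inc e ex)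
  subst  : ∀ {k} t (H : FinGraph t) es → IsSimple (toGraph H) → TD≤ ℓ (toGraph H) →
           (∀ i → TDMTDExpr ℓ k (es i)) → TDMTDExpr ℓ k (subst t H es)

data MWMTDExpr (h ℓ : ℕ) : Expr → Set₁ where
  bullet : MWMTDExpr h ℓ bullet
  union  : ∀ t (p : 2 ≤ t) es → (∀ i → MWMTDExpr h ℓ (es i)) → MWMTDExpr h ℓ (union t p es)
  join   : ∀ t (p : 2 ≤ t) es → (∀ i → MWMTDExpr h ℓ (es i)) → MWMTDExpr h ℓ (join t p es)
  subst  : ∀ t (H : FinGraph t) es → IsSimple (toGraph H) → (t ≤ h ⊎ TD≤ ℓ (toGraph H)) →
           (∀ i → MWMTDExpr h ℓ (es i)) → MWMTDExpr h ℓ (subst t H es)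

-- Graph classes (membership up to renaming; empty graph = empty expression)
TDMTD : ℕ → ℕ → Graph → Set₁
TDMTD k ℓ G = (G ≅ emptyG) ⊎ (∃ λ e → TDMTDExpr ℓ k e × (eval e ≅ G))

MWMTD : ℕ → ℕ → Graph → Set₁
MWMTD h ℓ G = (G ≅ emptyG) ⊎ (∃ λ e → MWMTDExpr h ℓ e × (eval e ≅ G))

{-# OPTIONS --safe #-}
-- Let T be the thin spider with ℓ legs (a clique c₁ … c_ℓ with a pendant vertex pᵢ at each cᵢ),
-- relabelled onto 2ℓ vertices, and G = T[T[⋯T[•]⋯]] with k + 1 nested substitutions; plainly
-- G ∈ MW_{2ℓ}MTD₀. T is prime, every vertex of T has both a neighbour and a non-neighbour, and
-- td(T) > ℓ. By induction on an expression of Inc-depth k we show that G does not embed into its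
-- value. An embedding of T[Q,…,Q] into H[G₁,…,Gₛ] either lands in a single Gᵢ (recurse), or picks
-- distinct blocks for the copies of Q and so induces T in H; that is impossible when H is the
-- edgeless or complete pattern of Union or Join, and when td(H) ≤ ℓ. An Inc vertex has at most one
-- preimage, so some copy of the (k-fold) graph inside T[…] avoids it, and the depth drops by one.

module Submission where

open import Defs
open import Data.Nat using (ℕ; _≤_; _*_; zero; suc; s≤s)
open import Data.Nat.Properties using (≤-refl)
open import Data.Bool using (Bool; true; false; not)
open import Data.Empty using (⊥; ⊥-elim)
open import Data.Fin using (Fin; zero; punchIn; _≟_)
open import Data.Fin.Properties using (any?; *↔×; 1↔⊤; 2↔Bool; punchIn-injective; punchInᵢ≢i)
open import Data.Maybe using (Maybe; just; nothing)
open import Data.Product using (Σ; ∃; _×_; _,_; proj₁; proj₂)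
open import Data.Product.Function.NonDependent.Propositional using (_×-↔_)
open import Data.Sum using (_⊎_; inj₁; inj₂)
open import Data.Unit using (tt)
open import Function using (_∘_)
open import Function.Bundles using (_↔_; Inverse; Injection)
open import Function.Properties.Inverse using (↔-refl; ↔-sym; ↔-trans; ↔⇒↣)
open import Relation.Nullary using (¬_; contradiction; Dec; yes; no; does; ¬?)
open import Relation.Nullary.Decidable using (decidable-stable; dec-true; dec-false; does-≡; map′; _×-dec_)
open import Relation.Unary using (Decidable)
open import Relation.Binary.PropositionalEquality
  using (_≡_; _≢_; refl; sym; trans; cong; cong₂; module ≡-Reasoning)
  renaming (subst to transport)

infix 4 _⊑_

record _⊑_ (G H : Graph) : Set where
  field
    emb           : V G → V H
    emb-injective : ∀ {u v} → emb u ≡ emb v → u ≡ v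
    emb-adj       : ∀ u v → adj H (emb u) (emb v) ≡ adj G u v
open _⊑_ public

⊑-trans : ∀ {G H K} → G ⊑ H → H ⊑ K → G ⊑ K
⊑-trans f g = record
  { emb           = emb g ∘ emb f
  ; emb-injective = emb-injective f ∘ emb-injective g
  ; emb-adj       = λ u v → trans (emb-adj g _ _) (emb-adj f u v)
  }

≅-refl : ∀ {G} → G ≅ G
≅-refl = record { bij = ↔-refl ; preserve = λ _ _ → refl }

≅⇒⊒ : ∀ {G H} → G ≅ H → H ⊑ G
≅⇒⊒ {G} {H} iso = record
  { emb           = from
  ; emb-injective = Injection.injective (↔⇒↣ (↔-sym bij))
  ; emb-adj       = λ u v → trans (preserve (from u) (from v))
                                  (cong₂ (adj H) (strictlyInverseˡ u) (strictlyInverseˡ v))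
  }
  where
  open _≅_ iso
  open Inverse bij

search : ∀ {X : Set} {n} {P : X → Set} → X ↔ Fin n → Decidable P → Dec (∃ P)
search {P = P} φ P? =
  map′ (λ (i , p) → from i , p)
       (λ (x , p) → to x , transport P (sym (strictlyInverseʳ x)) p)
       (any? (P? ∘ from))
  where open Inverse φ

nothing? : ∀ {A : Set} (m : Maybe A) → Dec (m ≡ nothing)
nothing? nothing  = yes refl
nothing? (just _) = no λ ()

does-≟-refl : ∀ {m} (i : Fin m) → does (i ≟ i) ≡ true
does-≟-refl i = dec-true (i ≟ i) refl

does-≟-injective : ∀ {m n} {g : Fin m → Fin n} → (∀ {i j} → g i ≡ g j → i ≡ j) →
                   ∀ i j → does (g i ≟ g j) ≡ does (i ≟ j)
does-≟-injective {g = g} g-injective i j = does-≡ (g i ≟ g j) (map′ (cong g) g-injective (i ≟ j))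

does-≟-punchIn : ∀ {n} (i : Fin (suc n)) j → does (i ≟ punchIn i j) ≡ false
does-≟-punchIn i j = dec-false (i ≟ punchIn i j) (punchInᵢ≢i i j ∘ sym)

module _ {t} (H : FinGraph t) (Gs : Fin t → Graph) where

  substAdj-inside : ∀ i x y → substAdj H Gs (i , x) (i , y) ≡ adj (Gs i) x y
  substAdj-inside i x y with i ≟ i
  ... | yes refl = refl
  ... | no i≢i   = ⊥-elim (i≢i refl)

  substAdj-across : ∀ {u v} → proj₁ u ≢ proj₁ v → substAdj H Gs u v ≡ H (proj₁ u) (proj₁ v)
  substAdj-across {i , _} {j , _} i≢j with i ≟ j
  ... | yes refl = ⊥-elim (i≢j refl)
  ... | no _     = refl

  InBlock : ∀ {G} → G ⊑ substG H Gs → Fin t → Set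
  InBlock f i = ∀ v → proj₁ (emb f v) ≡ i

  restrict : ∀ {G} (f : G ⊑ substG H Gs) {i} → InBlock f i → G ⊑ Gs i
  restrict f {i} f-in-i = record
    { emb           = λ v → inside (emb f v) (f-in-i v)
    ; emb-injective = λ {u} {v} → emb-injective f ∘ inside-injective _ _ (f-in-i u) (f-in-i v)
    ; emb-adj       = λ u v → trans (inside-adj _ _ (f-in-i u) (f-in-i v)) (emb-adj f u v)
    }
    where
    inside : (u : Σ (Fin t) (V ∘ Gs)) → proj₁ u ≡ i → V (Gs i)
    inside (_ , x) refl = x

    inside-injective : ∀ u v p q → inside u p ≡ inside v q → u ≡ v
    inside-injective (_ , x) (_ , y) refl refl refl = refl

    inside-adj : ∀ u v p q → adj (Gs i) (inside u p) (inside v q) ≡ substAdj H Gs u v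
    inside-adj (_ , x) (_ , y) refl refl = sym (substAdj-inside i x y)

  substG-simple : IsSimple (toGraph H) → (∀ i → IsSimple (Gs i)) → IsSimple (substG H Gs)
  substG-simple (H-sym , _) Gs-simple =
    adj-sym , λ (i , x) → trans (substAdj-inside i x x) (proj₂ (Gs-simple i) x)
    where
    adj-sym : ∀ u v → substAdj H Gs u v ≡ substAdj H Gs v u
    adj-sym (i , x) (j , y) = by-blocks (i ≟ j)
      where
      by-blocks : Dec (i ≡ j) → substAdj H Gs (i , x) (j , y) ≡ substAdj H Gs (j , y) (i , x)
      by-blocks (yes refl) = trans (substAdj-inside i x y)
                               (trans (proj₁ (Gs-simple i) x y) (sym (substAdj-inside i y x)))
      by-blocks (no i≢j)   = trans (substAdj-across i≢j)
                               (trans (H-sym i j) (sym (substAdj-across (i≢j ∘ sym))))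

unionAdj⇒same-block : ∀ {t} (Gs : Fin t → Graph) {u v} →
                      substAdj (λ _ _ → false) Gs u v ≡ true → proj₁ u ≡ proj₁ v
unionAdj⇒same-block Gs {u} {v} uv = decidable-stable (proj₁ u ≟ proj₁ v) λ differ →
  contradiction (trans (sym (substAdj-across _ Gs differ)) uv) λ ()

avoid-new : ∀ {B G ex} (f : B ⊑ incG G ex) → (∀ u → emb f u ≢ nothing) → B ⊑ G
avoid-new {B} {G} {ex} f new∉f = record
  { emb           = old
  ; emb-injective = λ {u} {v} p → emb-injective f (trans (old-eq u) (trans (cong just p) (sym (old-eq v))))
  ; emb-adj       = λ u v → trans (cong₂ (incAdj G ex) (sym (old-eq u)) (sym (old-eq v))) (emb-adj f u v)
  }
  where
  old-part : ∀ u → ∃ λ x → emb f u ≡ just x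
  old-part u with emb f u | new∉f u
  ... | just x  | _    = x , refl
  ... | nothing | ¬new = ⊥-elim (¬new refl)

  old : V B → V G
  old = proj₁ ∘ old-part

  old-eq : ∀ u → emb f u ≡ just (old u)
  old-eq = proj₂ ∘ old-part

TDExpr-zero-empty : ∀ {e} → TDExpr 0 e → ¬ V (eval e)
TDExpr-zero-empty circ ()
TDExpr-zero-empty (union _ _ _ td) (i , x) = TDExpr-zero-empty (td i) x

IsModule : (G : Graph) → (V G → Set) → Set
IsModule G M = ∀ {c d d′} → ¬ M c → M d → M d′ → adj G c d ≡ adj G c d′

-- Only decidable modules are quantified over: that is what the closure arguments need constructively.
IsPrime : Graph → Set₁
IsPrime G = ∀ {M} → Decidable M → IsModule G M → ∀ {x y} → x ≢ y → M x → M y → ∀ c → M c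

IsMixed : Graph → Set
IsMixed G = ∀ c → (∃ λ d → c ≢ d × adj G c d ≡ true) × (∃ λ d → c ≢ d × adj G c d ≡ false)

mixed-not-uniform : ∀ {G} → IsMixed G → ∀ c {b} → ¬ (∀ {d} → c ≢ d → adj G c d ≡ b)
mixed-not-uniform G-mixed c uniform with G-mixed c
... | (_ , c≢d , cd) , (_ , c≢d′ , cd′)
    with () ← trans (sym cd) (trans (uniform c≢d) (trans (sym (uniform c≢d′)) cd′))

-- The diagonal is ignored, since the pattern of Join is the constantly true matrix.
InducedIn : ∀ {t s} → FinGraph t → FinGraph s → Set
InducedIn {t} {s} T H = Σ (Fin t → Fin s) λ g → ∀ {a b} → a ≢ b → g a ≢ g b × T a b ≡ H (g a) (g b)

InducedIn⇒⊑ : ∀ {t s} {T : FinGraph t} {H : FinGraph s} →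
              (∀ a → T a a ≡ false) → (∀ x → H x x ≡ false) → InducedIn T H → toGraph T ⊑ toGraph H
InducedIn⇒⊑ {T = T} {H} T-irreflexive H-irreflexive (g , g-induces) = record
  { emb           = g
  ; emb-injective = λ {a} {b} ga≡gb → decidable-stable (a ≟ b) λ a≢b → proj₁ (g-induces a≢b) ga≡gb
  ; emb-adj       = adj-preserved
  }
  where
  adj-preserved : ∀ a b → H (g a) (g b) ≡ T a b
  adj-preserved a b with a ≟ b
  ... | yes refl = trans (H-irreflexive (g a)) (sym (T-irreflexive a))
  ... | no a≢b   = sym (proj₂ (g-induces a≢b))

module _ {t} {T : FinGraph t} (T-prime : IsPrime (toGraph T)) (T-mixed : IsMixed (toGraph T))
         {s} {H : FinGraph s} {Gs : Fin s → Graph} {Qs : Fin t → Graph}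
         (q : ∀ a → V (Qs a)) (f : substG T Qs ⊑ substG H Gs) where

  private
    block : Σ (Fin t) (V ∘ Qs) → Fin s
    block v = proj₁ (emb f v)

    g : Fin t → Fin s
    g a = block (a , q a)

    across : ∀ {a b x y} → block (a , x) ≢ block (b , y) → a ≢ b →
             T a b ≡ H (block (a , x)) (block (b , y))
    across {a} {b} {x} {y} blocks≢ a≢b = begin
      T a b                                         ≡⟨ substAdj-across T Qs a≢b ⟨
      substAdj T Qs (a , x) (b , y)                 ≡⟨ emb-adj f _ _ ⟨
      substAdj H Gs (emb f (a , x)) (emb f (b , y)) ≡⟨ substAdj-across H Gs blocks≢ ⟩
      H (block (a , x)) (block (b , y))             ∎
      where open ≡-Reasoning

    fibre-module : ∀ i → IsModule (toGraph T) (λ c → g c ≡ i)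
    fibre-module i {c} {d} {d′} gc≢i gd≡i gd′≡i = begin
      T c d          ≡⟨ across-fibre gd≡i ⟩
      H (g c) (g d)  ≡⟨ cong (H (g c)) (trans gd≡i (sym gd′≡i)) ⟩
      H (g c) (g d′) ≡⟨ across-fibre gd′≡i ⟨
      T c d′         ∎
      where
      open ≡-Reasoning
      across-fibre : ∀ {e} → g e ≡ i → T c e ≡ H (g c) (g e)
      across-fibre ge≡i = across (gc≢i ∘ λ gc≡ge → trans gc≡ge ge≡i)
                                 (gc≢i ∘ λ c≡e → trans (cong g c≡e) ge≡i)

    -- The fibre of g over g a is a module of T with two vertices, hence all of T; a vertex outside
    -- the block g a would then be adjacent to all others alike, contradicting mixedness.
    collapse : ∀ {a b} → a ≢ b → g a ≡ g b → InBlock H Gs f (g a)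
    collapse {a} a≢b ga≡gb (c , z) with block (c , z) ≟ g a
    ... | yes inside = inside
    ... | no outside = ⊥-elim (mixed-not-uniform T-mixed c toward)
      where
      fibre : ∀ x → g x ≡ g a
      fibre = T-prime (λ x → g x ≟ g a) (fibre-module (g a)) a≢b refl (sym ga≡gb)

      toward : ∀ {d} → c ≢ d → T c d ≡ H (block (c , z)) (g a)
      toward {d} c≢d = trans (across (outside ∘ λ p → trans p (fibre d)) c≢d) (cong (H _) (fibre d))

  block-or-induced : (∃ λ i → InBlock H Gs f i) ⊎ InducedIn T H
  block-or-induced with any? (λ a → any? (λ b → ¬? (a ≟ b) ×-dec (g a ≟ g b)))
  ... | yes (a , b , a≢b , ga≡gb) = inj₁ (g a , collapse a≢b ga≡gb)
  ... | no injective = inj₂ (g , λ a≢b → separated a≢b , across (separated a≢b) a≢b)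
    where
    separated : ∀ {a b} → a ≢ b → g a ≢ g b
    separated a≢b ga≡gb = injective (_ , _ , a≢b , ga≡gb)

relabel : ∀ {t} (G : Graph) → Fin t ↔ V G → FinGraph t
relabel G φ a b = adj G (Inverse.to φ a) (Inverse.to φ b)

module _ {t} {G : Graph} (φ : Fin t ↔ V G) where
  open Inverse φ

  relabel-≅ : toGraph (relabel G φ) ≅ G
  relabel-≅ = record { bij = φ ; preserve = λ _ _ → refl }

  relabel-simple : IsSimple G → IsSimple (toGraph (relabel G φ))
  relabel-simple (G-sym , G-irr) = (λ a b → G-sym (to a) (to b)) , G-irr ∘ to

  relabel-prime : IsPrime G → IsPrime (toGraph (relabel G φ))
  relabel-prime G-prime {M} M? M-module {x} {y} x≢y Mx My c =
    transport M (strictlyInverseʳ c)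
      (G-prime (M? ∘ from) pulled-module (x≢y ∘ to-injective) (back Mx) (back My) (to c))
    where
    to-injective : ∀ {a b} → to a ≡ to b → a ≡ b
    to-injective = Injection.injective (↔⇒↣ φ)
    back : ∀ {a} → M a → M (from (to a))
    back {a} = transport M (sym (strictlyInverseʳ a))
    pulled-module : IsModule G (M ∘ from)
    pulled-module {c} {d} {d′} ¬Mc Md Md′ =
      trans (sym (relabelled c d)) (trans (M-module ¬Mc Md Md′) (relabelled c d′))
      where
      relabelled : ∀ u v → relabel G φ (from u) (from v) ≡ adj G u v
      relabelled = emb-adj (≅⇒⊒ relabel-≅)

  relabel-mixed : IsMixed G → IsMixed (toGraph (relabel G φ))
  relabel-mixed G-mixed a = pull (proj₁ (G-mixed (to a))) , pull (proj₂ (G-mixed (to a)))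
    where
    pull : ∀ {b} → (∃ λ d → to a ≢ d × adj G (to a) d ≡ b) →
                   (∃ λ c → a ≢ c × relabel G φ a c ≡ b)
    pull (d , a≢d , ad) = from d , (λ a≡ → a≢d (trans (cong to a≡) (strictlyInverseˡ d))) ,
                          trans (cong (adj G (to a)) (strictlyInverseˡ d)) ad

pattern clique i  = (true , i)
pattern pendant i = (false , i)

spiderAdj : ∀ {m} → Bool × Fin m → Bool × Fin m → Bool
spiderAdj (clique i)  (clique j)  = not (does (i ≟ j))
spiderAdj (clique i)  (pendant j) = does (i ≟ j)
spiderAdj (pendant i) (clique j)  = does (i ≟ j)
spiderAdj (pendant _) (pendant _) = false

Spider : ℕ → Graph
Spider m = record { V = Bool × Fin m ; adj = spiderAdj }

spider-vertices : ∀ m → Fin (2 * m) ↔ V (Spider m)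
spider-vertices m = ↔-trans *↔× (2↔Bool ×-↔ ↔-refl)

spider-simple : ∀ m → IsSimple (Spider m)
spider-simple m = adj-sym , adj-irr
  where
  does-≟-sym : ∀ (i j : Fin m) → does (i ≟ j) ≡ does (j ≟ i)
  does-≟-sym i j = does-≡ (i ≟ j) (map′ sym sym (j ≟ i))
  adj-sym : ∀ u v → spiderAdj u v ≡ spiderAdj v u
  adj-sym (clique i)  (clique j)  = cong not (does-≟-sym i j)
  adj-sym (clique i)  (pendant j) = does-≟-sym i j
  adj-sym (pendant i) (clique j)  = does-≟-sym i j
  adj-sym (pendant _) (pendant _) = refl
  adj-irr : ∀ u → spiderAdj u u ≡ false
  adj-irr (clique i)  = cong not (does-≟-refl i)
  adj-irr (pendant _) = refl

spider-mixed : ∀ n → IsMixed (Spider (suc (suc n)))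
spider-mixed n (clique i)  = (pendant i , (λ ()) , does-≟-refl i) ,
                             (pendant (punchIn i zero) , (λ ()) , does-≟-punchIn i zero)
spider-mixed n (pendant i) = (clique i , (λ ()) , does-≟-refl i) ,
                             (clique (punchIn i zero) , (λ ()) , does-≟-punchIn i zero)

spider-prime : ∀ m → IsPrime (Spider m)
spider-prime m {M} M? M-module = two⇒all
  where
  separator∈ : ∀ z {x y} → M x → M y → spiderAdj z x ≡ true → spiderAdj z y ≡ false → M z
  separator∈ z Mx My zx zy with M? z
  ... | yes Mz  = Mz
  ... | no ¬Mz with () ← trans (sym zx) (trans (M-module ¬Mz Mx My) zy)

  leg⇒all : ∀ {i} → M (clique i) → M (pendant i) → ∀ v → M v
  leg⇒all {i} Mc Mp (clique k) with k ≟ i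
  ... | yes refl = Mc
  ... | no k≢i   = separator∈ (clique k) Mc Mp (cong not (dec-false (k ≟ i) k≢i)) (dec-false (k ≟ i) k≢i)
  leg⇒all {i} Mc Mp (pendant k) with k ≟ i
  ... | yes refl = Mp
  ... | no k≢i   =
    separator∈ (pendant k) (leg⇒all Mc Mp (clique k)) Mc (does-≟-refl k) (dec-false (k ≟ i) k≢i)

  two⇒all : ∀ {x y} → x ≢ y → M x → M y → ∀ v → M v
  two⇒all {clique i} {clique j} x≢y Mx My =
    leg⇒all Mx (separator∈ (pendant i) Mx My (does-≟-refl i) (dec-false (i ≟ j) (x≢y ∘ cong clique)))
  two⇒all {clique i} {pendant j} _ Mx My with i ≟ j
  ... | yes refl = leg⇒all Mx My
  ... | no _     = leg⇒all Mx (separator∈ (pendant i) Mx My (does-≟-refl i) refl)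
  two⇒all {pendant _} {clique _} x≢y Mx My = two⇒all (x≢y ∘ sym) My Mx
  two⇒all {pendant i} {pendant j} x≢y Mx My =
    leg⇒all (separator∈ (clique i) Mx My (does-≟-refl i) (dec-false (i ≟ j) (x≢y ∘ cong pendant))) Mx

leg-removal : ∀ {m} (i : Fin (suc m)) → Spider m ⊑ Spider (suc m)
leg-removal {m} i = record
  { emb           = λ (b , j) → b , punchIn i j
  ; emb-injective = λ p → cong₂ _,_ (cong proj₁ p) (punchIn-injective i _ _ (cong proj₂ p))
  ; emb-adj       = adj-punched
  }
  where
  punched : ∀ j j′ → does (punchIn i j ≟ punchIn i j′) ≡ does (j ≟ j′)
  punched = does-≟-injective (punchIn-injective i _ _)
  adj-punched : ∀ u v → spiderAdj (proj₁ u , punchIn i (proj₂ u)) (proj₁ v , punchIn i (proj₂ v))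
                      ≡ spiderAdj u v
  adj-punched (clique j)  (clique j′)  = cong not (punched j j′)
  adj-punched (clique j)  (pendant j′) = punched j j′
  adj-punched (pendant j) (clique j′)  = punched j j′
  adj-punched (pendant _) (pendant _)  = refl

clique≢pendant : ∀ {m} {i j : Fin m} → _≢_ {A = V (Spider m)} (clique i) (pendant j)
clique≢pendant ()

spider-⋢-TDExpr : ∀ {m e} → TDExpr (suc m) e → ¬ (Spider (suc m) ⊑ eval e)
spider-⋢-TDExpr circ f = emb f (clique zero)
spider-⋢-TDExpr (union _ _ _ td) f = spider-⋢-TDExpr (td _) (restrict _ _ f in-block)
  where
  block : V (Spider _) → Fin _
  block v = proj₁ (emb f v)
  adjacent⇒same-block : ∀ {u v} → spiderAdj u v ≡ true → block u ≡ block v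
  adjacent⇒same-block {u} {v} uv = unionAdj⇒same-block _ (trans (emb-adj f u v) uv)
  clique-in-block : ∀ j → block (clique j) ≡ block (clique zero)
  clique-in-block j with j ≟ zero
  ... | yes refl = refl
  ... | no j≢0   = adjacent⇒same-block (cong not (dec-false (j ≟ zero) j≢0))
  in-block : ∀ v → block v ≡ block (clique zero)
  in-block (clique j)  = clique-in-block j
  in-block (pendant j) = trans (adjacent⇒same-block (does-≟-refl j)) (clique-in-block j)
spider-⋢-TDExpr {zero} (inc _ _ td) f =
  clique≢pendant (emb-injective f (trans (new (clique zero)) (sym (new (pendant zero)))))
  where
  new : ∀ v → emb f v ≡ nothing
  new v with emb f v
  ... | nothing = refl
  ... | just x  = ⊥-elim (TDExpr-zero-empty td x)
spider-⋢-TDExpr {suc m} (inc _ _ td) f with search (↔-sym (spider-vertices (suc (suc m)))) (nothing? ∘ emb f)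
... | yes ((_ , j) , fv≡new) = spider-⋢-TDExpr td (avoid-new (⊑-trans (leg-removal j) f)
        λ (_ , k) fu≡new → punchInᵢ≢i j k (cong proj₂ (emb-injective f (trans fu≡new (sym fv≡new)))))
... | no none = spider-⋢-TDExpr td (avoid-new (⊑-trans (leg-removal zero) f) λ u fu≡new → none (_ , fu≡new))

module _ {t} (T : FinGraph t) where

  power : ℕ → Expr
  power zero    = bullet
  power (suc k) = subst t T (λ _ → power k)

  copy : ∀ k (a : Fin t) → eval (power k) ⊑ eval (power (suc k))
  copy k a = record
    { emb           = a ,_
    ; emb-injective = λ { refl → refl }
    ; emb-adj       = substAdj-inside T _ a
    }

  power-finite : ∀ k → IsFinite (eval (power k))
  power-finite zero = 1 , ↔-sym 1↔⊤
  power-finite (suc k) with power-finite k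
  ... | m , φ = t * m , ↔-trans (↔-refl ×-↔ φ) (↔-sym *↔×)

  power-simple : IsSimple (toGraph T) → ∀ k → IsSimple (eval (power k))
  power-simple _       zero    = (λ _ _ → refl) , (λ _ → refl)
  power-simple T-simple (suc k) = substG-simple T _ T-simple (λ _ → power-simple T-simple k)

  power-MW : ∀ {h ℓ} → IsSimple (toGraph T) → t ≤ h → ∀ k → MWMTDExpr h ℓ (power k)
  power-MW _        _   zero    = bullet
  power-MW T-simple t≤h (suc k) = subst t T _ T-simple (inj₁ t≤h) (λ _ → power-MW T-simple t≤h k)

module _ {t} {T : FinGraph t} {ℓ}
         (T-prime : IsPrime (toGraph T)) (T-mixed : IsMixed (toGraph T))
         (T-irreflexive : ∀ a → T a a ≡ false)
         (T-deep : ∀ {e} → TDExpr ℓ e → ¬ (toGraph T ⊑ eval e))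
         (o : Fin t) where

  private
    root : ∀ k → V (eval (power T k))
    root zero    = tt
    root (suc k) = o , root k

    o′ : Fin t
    o′ = proj₁ (proj₁ (T-mixed o))

    o≢o′ : o ≢ o′
    o≢o′ = proj₁ (proj₂ (proj₁ (T-mixed o)))

  mutual
    power-⋢-TDMTDExpr : ∀ {k e} → TDMTDExpr ℓ k e → ¬ (eval (power T (suc k)) ⊑ eval e)
    power-⋢-TDMTDExpr {k} circ f = emb f (o , root k)
    power-⋢-TDMTDExpr {k} bullet f = o≢o′ (cong proj₁ (emb-injective f {o , root k} {o′ , root k} refl))
    power-⋢-TDMTDExpr (union _ _ _ ch) f = descend ch f λ (_ , g-induces) →
      mixed-not-uniform T-mixed o (proj₂ ∘ g-induces)
    power-⋢-TDMTDExpr (join _ _ _ ch) f = descend ch f λ (_ , g-induces) →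
      mixed-not-uniform T-mixed o (proj₂ ∘ g-induces)
    power-⋢-TDMTDExpr (subst _ H _ (_ , H-irreflexive) (e , td , e≅H) ch) f = descend ch f λ induced →
      T-deep td (⊑-trans (InducedIn⇒⊑ T-irreflexive H-irreflexive induced) (≅⇒⊒ e≅H))
    -- The new vertex has at most one preimage, so the copy at o or the one at o′ avoids it.
    power-⋢-TDMTDExpr {suc k} (inc _ _ ch) f
      with search (proj₂ (power-finite T (suc k))) (nothing? ∘ emb f ∘ (o ,_))
    ... | yes (u , fu≡new) = power-⋢-TDMTDExpr ch (avoid-new (⊑-trans (copy T (suc k) o′) f)
            λ w fw≡new → o≢o′ (sym (cong proj₁ (emb-injective f (trans fw≡new (sym fu≡new))))))
    ... | no none = power-⋢-TDMTDExpr ch (avoid-new (⊑-trans (copy T (suc k) o) f)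
            λ w fw≡new → none (w , fw≡new))

    descend : ∀ {k s} {H : FinGraph s} {es : Fin s → Expr} → (∀ i → TDMTDExpr ℓ k (es i)) →
              eval (power T (suc k)) ⊑ substG H (eval ∘ es) → ¬ InducedIn T H → ⊥
    descend {k} ch f not-induced with block-or-induced T-prime T-mixed (λ _ → root k) f
    ... | inj₁ (i , f-in-i) = power-⋢-TDMTDExpr (ch i) (restrict _ _ f f-in-i)
    ... | inj₂ induced      = not-induced induced

  power-∉-TDMTD : ∀ k → ¬ TDMTD k ℓ (eval (power T (suc k)))
  power-∉-TDMTD k (inj₁ G≅∅)            = Inverse.to (_≅_.bij G≅∅) (o , root k)
  power-∉-TDMTD k (inj₂ (e , td , e≅G)) = power-⋢-TDMTDExpr td (≅⇒⊒ e≅G)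

lemma34 : (k ℓ : ℕ) → 2 ≤ k → 2 ≤ ℓ →
    Σ Graph (λ G → IsSimple G × IsFinite G × (¬ TDMTD k ℓ G) × MWMTD (2 * ℓ) 0 G)
lemma34 k ℓ@(suc (suc n)) _ (s≤s (s≤s _)) =
  eval (power T (suc k)) ,
  power-simple T T-simple (suc k) ,
  power-finite T (suc k) ,
  power-∉-TDMTD (relabel-prime φ (spider-prime ℓ)) (relabel-mixed φ (spider-mixed n))
                (proj₂ T-simple) T-deep zero k ,
  inj₂ (power T (suc k) , power-MW T T-simple ≤-refl (suc k) , ≅-refl)
  where
  φ : Fin (2 * ℓ) ↔ V (Spider ℓ)
  φ = spider-vertices ℓ
  T : FinGraph (2 * ℓ)
  T = relabel (Spider ℓ) φ
  T-simple : IsSimple (toGraph T)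
  T-simple = relabel-simple φ (spider-simple ℓ)
  T-deep : ∀ {e} → TDExpr ℓ e → ¬ (toGraph T ⊑ eval e)
  T-deep td = spider-⋢-TDExpr td ∘ ⊑-trans (≅⇒⊒ (relabel-≅ φ))
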